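{- For each integer $k\ge 4$ and every integer $w\ge 4$, $m_2^{(2)}(k-1,w)$ equals the Griesmer upper bound, i.e. the largest integer $n\ge w$ such that $n\ge g_2^{(k-3)}(k,n-w)$.
   Context: For a prime power $q$, integers $0\le r< N$ and $w\ge 0$, $m_q^{(r)}(N,w)$ denotes the maximum total multiplicity of a multiset of points in the projective space $\mathrm{PG}(N,q)$ (a map $\mathcal{M}$ from points to nonnegative integers) such that every $r$-dimensional projective subspace $S$ has multiplicity $\sum_{P\in S}\mathcal{M}(P)\le w$. For integers $k>s\ge1$ and $d\ge0$, $g_q^{(s)}(k,d)=d+\sum_{i=1}^{k-s}\left\lceil \frac{d}{q^iv_s}\right\rceil$ with $v_s=(q^s-1)/(q-1)$. -}

module Defs where

open import Data.Nat using (ℕ; zero; suc; _+_; _*_; _∸_; _^_; _≤_)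
open import Data.Nat.DivMod using (_/_)
open import Data.Bool using (Bool; true; false; _xor_; if_then_else_)
open import Data.Vec using (Vec; []; _∷_; replicate; zipWith)
open import Data.List using (List; []; _∷_; map; _++_)
open import Data.Nat.ListAction using (sum)
open import Data.Product using (_×_; _,_; Σ; ∃)
open import Relation.Binary.PropositionalEquality using (_≡_)
open import Relation.Nullary using (¬_)

-- total division (division by zero returns 0; never used with zero below
-- when q ≥ 2 and s ≥ 1)
divℕ : ℕ → ℕ → ℕ
divℕ a zero    = 0
divℕ a (suc b) = a / suc b

ceilDiv : ℕ → ℕ → ℕ
ceilDiv a zero    = 0
ceilDiv a (suc b) = (a + b) / suc b

v : ℕ → ℕ → ℕ
v q s = divℕ (q ^ s ∸ 1) (q ∸ 1)

sumFrom1 : ℕ → (ℕ → ℕ) → ℕ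
sumFrom1 zero    f = 0
sumFrom1 (suc n) f = sumFrom1 n f + f (suc n)

g : ℕ → ℕ → ℕ → ℕ → ℕ
g q s k d = d + sumFrom1 (k ∸ s) (λ i → ceilDiv d (q ^ i * v q s))

Vec2 : ℕ → Set
Vec2 k = Vec Bool k

zeroV : ∀ {k} → Vec2 k
zeroV {k} = replicate k false

_⊕_ : ∀ {k} → Vec2 k → Vec2 k → Vec2 k
_⊕_ = zipWith _xor_

_·_ : ∀ {k} → Bool → Vec2 k → Vec2 k
a · u = if a then u else zeroV

allVecs : (k : ℕ) → List (Vec2 k)
allVecs zero    = [] ∷ []
allVecs (suc k) = map (false ∷_) (allVecs k) ++ map (true ∷_) (allVecs k)

isZeroV : ∀ {k} → Vec2 k → Bool
isZeroV []          = true
isZeroV (true ∷ u)  = false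
isZeroV (false ∷ u) = isZeroV u

-- A multiset of points of PG(k-1,2): a multiplicity for each vector;
-- only nonzero vectors (the projective points) are counted.
Multiset : ℕ → Set
Multiset k = Vec2 k → ℕ

total : ∀ {k} → Multiset k → ℕ
total {k} M = sum (map (λ u → if isZeroV u then 0 else M u) (allVecs k))

LinIndep3 : ∀ {k} → Vec2 k → Vec2 k → Vec2 k → Set
LinIndep3 u₁ u₂ u₃ =
  ∀ a b c → ((a · u₁) ⊕ (b · u₂)) ⊕ (c · u₃) ≡ zeroV →
  (a ≡ false) × (b ≡ false) × (c ≡ false)

nonzeroTriples : List (Bool × Bool × Bool)
nonzeroTriples =
  (true , false , false) ∷ (false , true , false) ∷ (true , true , false) ∷
  (false , false , true) ∷ (true , false , true) ∷ (false , true , true) ∷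
  (true , true , true) ∷ []

planeMult : ∀ {k} → Multiset k → Vec2 k → Vec2 k → Vec2 k → ℕ
planeMult M u₁ u₂ u₃ =
  sum (map (λ { (a , b , c) → M (((a · u₁) ⊕ (b · u₂)) ⊕ (c · u₃)) }) nonzeroTriples)

PlaneBounded : ∀ {k} → Multiset k → ℕ → Set
PlaneBounded {k} M w =
  ∀ (u₁ u₂ u₃ : Vec2 k) → LinIndep3 u₁ u₂ u₃ → planeMult M u₁ u₂ u₃ ≤ w

Achievable : ℕ → ℕ → ℕ → Set
Achievable k w n = Σ (Multiset k) (λ M → PlaneBounded M w × total M ≡ n)

IsMax : (ℕ → Set) → ℕ → Set
IsMax P n = P n × (∀ m → P m → m ≤ n)

-- m_2^{(2)}(k-1, w) = n
m2plane : ℕ → ℕ → ℕ → Set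
m2plane k w n = IsMax (Achievable k w) n

-- Write V = v_{k-3} = 2^(k-3) - 1, so that 2^k = 8V + 8 and g_2^{(k-3)}(k, d) = d + ⌈d/2V⌉ + ⌈d/4V⌉ + ⌈d/8V⌉.
--
-- Let M have total n = w + d and every plane of multiplicity at most w.
-- Summing the plane bound over the planes through a fixed line shows that every line has
-- multiplicity at most w - ⌈d/2V⌉; summing this over the lines through a point bounds every
-- point by w - ⌈d/2V⌉ - ⌈d/4V⌉, and summing over all points gives ⌈d/2V⌉ + ⌈d/4V⌉ + ⌈d/8V⌉ ≤ w,
-- that is g(n - w) ≤ n.  Each summation runs over all vectors x, pairing a subspace S with the
-- span of S and x.
--
-- For w = 7a + r, add to a copies of PG(k-1,2) (7 points on every plane)
-- q complements of a hyperplane (at most 4 on a plane), c complements of a codimension-2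
-- subspace (at most 6) and e single points (at most 1), where r = 4q + 6c + e.  This has
-- n = w + (8a + t)V points, t = 4q + 6c; for the pieces dictated by w mod 7 this n satisfies
-- g(n - w) ≤ n while every larger n violates it.

module Submission where

open import Defs
open import Data.Nat
open import Data.Nat.Properties
open import Data.Nat.DivMod using (_/_; _%_; m<n*o⇒m/o<n; m≡m%n+[m/n]*n; m%n<n; m/n*n≤m; n/1≡n)
open import Data.Nat.ListAction using (sum)
open import Data.Nat.ListAction.Properties using (sum-++)
open import Data.Nat.Tactic.RingSolver using (solve-∀)
open import Data.Bool using (Bool; true; false; _xor_; _∧_; _∨_; if_then_else_)
open import Data.Bool.Properties using (xor-comm; xor-assoc; xor-identityˡ; xor-identityʳ; xor-same; xor-∧-commutativeRing)
import Data.Bool.Properties as Bool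
open import Algebra.Bundles using (CommutativeRing)
open import Algebra.Properties.CommutativeSemigroup (CommutativeRing.+-commutativeSemigroup xor-∧-commutativeRing)
  using (interchange)
open import Data.Vec using (Vec; []; _∷_)
import Data.Vec as Vec
open import Data.Vec.Properties using (zipWith-comm; zipWith-assoc; zipWith-identityˡ; zipWith-identityʳ; ≡-dec)
open import Data.List using ([]; _∷_; map; _++_)
open import Data.List.Properties using (map-cong; map-++; map-∘)
open import Data.Product using (Σ; _×_; _,_; proj₁)
open import Data.Empty using (⊥-elim)
open import Function using (_∘_)
open import Relation.Binary.Definitions using (DecidableEquality)
open import Relation.Binary.PropositionalEquality
open import Relation.Nullary using (Dec; yes; no; ¬_; does; contradiction)
open import Relation.Nullary.Decidable using (dec-true; dec-false; map′)

private
  variable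
    j k : ℕ

ceilDiv-least : ∀ {a b t} → 1 ≤ b → a ≤ b * t → ceilDiv a b ≤ t
ceilDiv-least {a} {suc b} {t} _ a≤bt = s≤s⁻¹ (m<n*o⇒m/o<n {a + b} {suc t} {suc b} (begin-strict
  a + b               ≤⟨ +-monoˡ-≤ b a≤bt ⟩
  suc b * t + b       <⟨ n<1+n _ ⟩
  suc (suc b * t + b) ≡⟨ expand b t ⟩
  suc t * suc b       ∎))
  where
  open ≤-Reasoning
  expand : ∀ b t → suc (suc b * t + b) ≡ suc t * suc b
  expand = solve-∀

≤*ceilDiv : ∀ a {b} → 1 ≤ b → a ≤ b * ceilDiv a b
≤*ceilDiv a {suc b} _ = +-cancelʳ-≤ b a (suc b * q) (begin
  a + b                       ≡⟨ m≡m%n+[m/n]*n (a + b) (suc b) ⟩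
  (a + b) % suc b + q * suc b ≤⟨ +-monoˡ-≤ (q * suc b) (s≤s⁻¹ (m%n<n (a + b) (suc b))) ⟩
  b + q * suc b               ≡⟨ trans (+-comm b _) (cong (_+ b) (*-comm q (suc b))) ⟩
  suc b * q + b               ∎)
  where
  open ≤-Reasoning
  q = (a + b) / suc b

<-ceilDiv : ∀ {a b t} → 1 ≤ b → b * t < a → t < ceilDiv a b
<-ceilDiv {a} {b} {t} 1≤b bt<a with t <? ceilDiv a b
... | yes t<⌈a/b⌉ = t<⌈a/b⌉
... | no t≮⌈a/b⌉ = contradiction (≤-trans (≤*ceilDiv a 1≤b) (*-monoʳ-≤ b (≮⇒≥ t≮⌈a/b⌉))) (<⇒≱ bt<a)

module _ {A : Set} where

  sum-map-+ : ∀ (f g : A → ℕ) xs → sum (map (λ x → f x + g x) xs) ≡ sum (map f xs) + sum (map g xs)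
  sum-map-+ f g [] = refl
  sum-map-+ f g (x ∷ xs) = trans (cong (f x + g x +_) (sum-map-+ f g xs)) (+-+-interchange (f x) (g x) _ _)
    where
    +-+-interchange : ∀ a b c d → a + b + (c + d) ≡ a + c + (b + d)
    +-+-interchange = solve-∀

  sum-map-* : ∀ c (f : A → ℕ) xs → sum (map (λ x → c * f x) xs) ≡ c * sum (map f xs)
  sum-map-* c f [] = sym (*-zeroʳ c)
  sum-map-* c f (x ∷ xs) = trans (cong (c * f x +_) (sum-map-* c f xs)) (sym (*-distribˡ-+ c (f x) _))

  sum-map-≤ : ∀ {f g : A → ℕ} → (∀ x → f x ≤ g x) → ∀ xs → sum (map f xs) ≤ sum (map g xs)
  sum-map-≤ f≤g [] = z≤n
  sum-map-≤ f≤g (x ∷ xs) = +-mono-≤ (f≤g x) (sum-map-≤ f≤g xs)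

-- The vector space GF(2)^k

⊕-comm : ∀ (x y : Vec2 k) → x ⊕ y ≡ y ⊕ x
⊕-comm = zipWith-comm xor-comm

⊕-assoc : ∀ (x y z : Vec2 k) → (x ⊕ y) ⊕ z ≡ x ⊕ (y ⊕ z)
⊕-assoc = zipWith-assoc xor-assoc

⊕-identityˡ : ∀ (x : Vec2 k) → zeroV ⊕ x ≡ x
⊕-identityˡ = zipWith-identityˡ xor-identityˡ

⊕-identityʳ : ∀ (x : Vec2 k) → x ⊕ zeroV ≡ x
⊕-identityʳ = zipWith-identityʳ xor-identityʳ

⊕-same : ∀ (x : Vec2 k) → x ⊕ x ≡ zeroV
⊕-same [] = refl
⊕-same (b ∷ x) = cong₂ _∷_ (xor-same b) (⊕-same x)

⊕-cancelˡ : ∀ (x y : Vec2 k) → x ⊕ (x ⊕ y) ≡ y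
⊕-cancelˡ x y = begin
  x ⊕ (x ⊕ y) ≡⟨ ⊕-assoc x x y ⟨
  (x ⊕ x) ⊕ y ≡⟨ cong (_⊕ y) (⊕-same x) ⟩
  zeroV ⊕ y   ≡⟨ ⊕-identityˡ y ⟩
  y           ∎
  where open ≡-Reasoning

⊕≡zeroV⇒≡ : ∀ {x y : Vec2 k} → x ⊕ y ≡ zeroV → x ≡ y
⊕≡zeroV⇒≡ {x = x} {y} x⊕y≡0 = begin
  x           ≡⟨ ⊕-identityʳ x ⟨
  x ⊕ zeroV   ≡⟨ cong (x ⊕_) (⊕-same y) ⟨
  x ⊕ (y ⊕ y) ≡⟨ ⊕-assoc x y y ⟨
  (x ⊕ y) ⊕ y ≡⟨ cong (_⊕ y) x⊕y≡0 ⟩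
  zeroV ⊕ y   ≡⟨ ⊕-identityˡ y ⟩
  y           ∎
  where open ≡-Reasoning

⊕-interchange : ∀ (w x y z : Vec2 k) → (w ⊕ x) ⊕ (y ⊕ z) ≡ (w ⊕ y) ⊕ (x ⊕ z)
⊕-interchange []      []      []      []      = refl
⊕-interchange (a ∷ w) (b ∷ x) (c ∷ y) (d ∷ z) = cong₂ _∷_ (interchange a b c d) (⊕-interchange w x y z)

·-distribʳ-xor : ∀ a b (u : Vec2 k) → (a xor b) · u ≡ (a · u) ⊕ (b · u)
·-distribʳ-xor true  true  u = sym (⊕-same u)
·-distribʳ-xor true  false u = sym (⊕-identityʳ u)
·-distribʳ-xor false b     u = sym (⊕-identityˡ (b · u))

_≟ᵥ_ : DecidableEquality (Vec2 k)
_≟ᵥ_ = ≡-dec Bool._≟_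

δ : Vec2 k → Vec2 k → ℕ
δ u x = if does (u ≟ᵥ x) then 1 else 0

δ-≡ : ∀ {u x : Vec2 k} → u ≡ x → δ u x ≡ 1
δ-≡ {u = u} {x} u≡x = cong (λ b → if b then 1 else 0) (dec-true (u ≟ᵥ x) u≡x)

δ-≢ : ∀ {u x : Vec2 k} → u ≢ x → δ u x ≡ 0
δ-≢ {u = u} {x} u≢x = cong (λ b → if b then 1 else 0) (dec-false (u ≟ᵥ x) u≢x)

δ-comm : ∀ (u x : Vec2 k) → δ u x ≡ δ x u
δ-comm u x with u ≟ᵥ x
... | yes u≡x = sym (δ-≡ (sym u≡x))
... | no u≢x  = sym (δ-≢ (u≢x ∘ sym))

-- Sums over GF(2)^k

sumV : (Vec2 k → ℕ) → ℕ
sumV {k} f = sum (map f (allVecs k))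

sumV-cong : ∀ {f g : Vec2 k → ℕ} → (∀ x → f x ≡ g x) → sumV f ≡ sumV g
sumV-cong {k} f≗g = cong sum (map-cong f≗g (allVecs k))

sumV-+ : ∀ (f g : Vec2 k → ℕ) → sumV (λ x → f x + g x) ≡ sumV f + sumV g
sumV-+ {k} f g = sum-map-+ f g (allVecs k)

sumV-* : ∀ c (f : Vec2 k → ℕ) → sumV (λ x → c * f x) ≡ c * sumV f
sumV-* {k} c f = sum-map-* c f (allVecs k)

sumV-≤ : ∀ {f g : Vec2 k → ℕ} → (∀ x → f x ≤ g x) → sumV f ≤ sumV g
sumV-≤ {k} f≤g = sum-map-≤ f≤g (allVecs k)

sumV-suc : ∀ (f : Vec2 (suc k) → ℕ) → sumV f ≡ sumV (λ x → f (false ∷ x)) + sumV (λ x → f (true ∷ x))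
sumV-suc {k} f = begin
  sum (map f (map (false ∷_) xs ++ map (true ∷_) xs))
    ≡⟨ cong sum (map-++ f (map (false ∷_) xs) _) ⟩
  sum (map f (map (false ∷_) xs) ++ map f (map (true ∷_) xs))
    ≡⟨ sum-++ (map f (map (false ∷_) xs)) _ ⟩
  sum (map f (map (false ∷_) xs)) + sum (map f (map (true ∷_) xs))
    ≡⟨ cong₂ _+_ (cong sum (map-∘ xs)) (cong sum (map-∘ xs)) ⟨
  sumV (λ x → f (false ∷ x)) + sumV (λ x → f (true ∷ x)) ∎
  where
  open ≡-Reasoning
  xs = allVecs k

sumV-const : ∀ k c → sumV {k} (λ _ → c) ≡ 2 ^ k * c
sumV-const zero    c = trans (+-identityʳ c) (sym (*-identityˡ c))
sumV-const (suc k) c = begin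
  sumV {suc k} (λ _ → c)                  ≡⟨ sumV-suc {k} (λ _ → c) ⟩
  sumV {k} (λ _ → c) + sumV {k} (λ _ → c) ≡⟨ cong₂ _+_ (sumV-const k c) (sumV-const k c) ⟩
  2 ^ k * c + 2 ^ k * c                   ≡⟨ double (2 ^ k) c ⟩
  2 ^ suc k * c                           ∎
  where
  open ≡-Reasoning
  double : ∀ p c → p * c + p * c ≡ 2 * p * c
  double = solve-∀

sumV-zero : ∀ k → sumV {k} (λ _ → 0) ≡ 0
sumV-zero k = trans (sumV-const k 0) (*-zeroʳ (2 ^ k))

sumV-shift : ∀ (u : Vec2 k) (f : Vec2 k → ℕ) → sumV (λ x → f (u ⊕ x)) ≡ sumV f
sumV-shift []          f = refl
sumV-shift (false ∷ u) f = begin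
  sumV (λ x → f ((false ∷ u) ⊕ x))
    ≡⟨ sumV-suc (λ x → f ((false ∷ u) ⊕ x)) ⟩
  sumV (λ x → f (false ∷ (u ⊕ x))) + sumV (λ x → f (true ∷ (u ⊕ x)))
    ≡⟨ cong₂ _+_ (sumV-shift u (f ∘ (false ∷_))) (sumV-shift u (f ∘ (true ∷_))) ⟩
  sumV (λ x → f (false ∷ x)) + sumV (λ x → f (true ∷ x))
    ≡⟨ sumV-suc f ⟨
  sumV f ∎
  where open ≡-Reasoning
sumV-shift (true ∷ u) f = begin
  sumV (λ x → f ((true ∷ u) ⊕ x))
    ≡⟨ sumV-suc (λ x → f ((true ∷ u) ⊕ x)) ⟩
  sumV (λ x → f (true ∷ (u ⊕ x))) + sumV (λ x → f (false ∷ (u ⊕ x)))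
    ≡⟨ cong₂ _+_ (sumV-shift u (f ∘ (true ∷_))) (sumV-shift u (f ∘ (false ∷_))) ⟩
  sumV (λ x → f (true ∷ x)) + sumV (λ x → f (false ∷ x))
    ≡⟨ trans (sumV-suc f) (+-comm (sumV (λ x → f (false ∷ x))) _) ⟨
  sumV f ∎
  where open ≡-Reasoning

-- δ (a ∷ x) (b ∷ p) computes to δ x p when a and b are the same literal, and to 0 otherwise.
sumV-δ : ∀ (p : Vec2 k) → sumV (λ x → δ x p) ≡ 1
sumV-δ []                  = refl
sumV-δ {suc k} (false ∷ p) =
  trans (sumV-suc (λ x → δ x (false ∷ p))) (cong₂ _+_ (sumV-δ p) (sumV-zero k))
sumV-δ {suc k} (true ∷ p)  =
  trans (sumV-suc (λ x → δ x (true ∷ p))) (cong₂ _+_ (sumV-zero k) (sumV-δ p))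

sumV-comm : ∀ (F : Vec2 k → Vec2 j → ℕ) → sumV (λ x → sumV (F x)) ≡ sumV (λ c → sumV (λ x → F x c))
sumV-comm {k} {j} F = over (allVecs j)
  where
  over : ∀ cs → sumV (λ x → sum (map (F x) cs)) ≡ sum (map (λ c → sumV (λ x → F x c)) cs)
  over []       = sumV-zero k
  over (c ∷ cs) = trans (sumV-+ (λ x → F x c) _) (cong (sumV (λ x → F x c) +_) (over cs))

-- total M is sumV (onPoints M) by definition.
onPoints : Multiset k → Multiset k
onPoints M u = if isZeroV u then 0 else M u

onPoints-≤ : ∀ (M : Multiset k) x → onPoints M x ≤ M x
onPoints-≤ M x with isZeroV x
... | true  = z≤n
... | false = ≤-refl

isZeroV-zeroV : ∀ k → isZeroV (zeroV {k}) ≡ true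
isZeroV-zeroV zero    = refl
isZeroV-zeroV (suc k) = isZeroV-zeroV k

onPoints-zeroV : ∀ (M : Multiset k) → onPoints M zeroV ≡ 0
onPoints-zeroV {k} M = cong (if_then 0 else M zeroV) (isZeroV-zeroV k)

total+zeroV : ∀ (M : Multiset k) → total M + M zeroV ≡ sumV M
total+zeroV {zero}  M = +-comm 0 (M [])
total+zeroV {suc k} M = begin
  total M + M zeroV
    ≡⟨ cong (_+ M zeroV) (sumV-suc (onPoints M)) ⟩
  total (M ∘ (false ∷_)) + sumV (M ∘ (true ∷_)) + M (false ∷ zeroV)
    ≡⟨ swap (total (M ∘ (false ∷_))) _ _ ⟩
  total (M ∘ (false ∷_)) + M (false ∷ zeroV) + sumV (M ∘ (true ∷_))
    ≡⟨ cong (_+ sumV (M ∘ (true ∷_))) (total+zeroV (M ∘ (false ∷_))) ⟩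
  sumV (M ∘ (false ∷_)) + sumV (M ∘ (true ∷_))
    ≡⟨ sumV-suc M ⟨
  sumV M ∎
  where
  open ≡-Reasoning
  swap : ∀ a b c → a + b + c ≡ a + c + b
  swap = solve-∀

total-vanishing : ∀ (M : Multiset k) → M zeroV ≡ 0 → total M ≡ sumV M
total-vanishing M M0≡0 = trans (sym (+-identityʳ (total M))) (trans (cong (total M +_) (sym M0≡0)) (total+zeroV M))

-- Spans and the averaging argument

lincomb : Vec (Vec2 k) j → Vec2 j → Vec2 k
lincomb []       []      = zeroV
lincomb (g ∷ gs) (b ∷ c) = (b · g) ⊕ lincomb gs c

lincomb-⊕ : ∀ (gs : Vec (Vec2 k) j) c c′ → lincomb gs (c ⊕ c′) ≡ lincomb gs c ⊕ lincomb gs c′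
lincomb-⊕ []       []      []        = sym (⊕-identityˡ zeroV)
lincomb-⊕ (g ∷ gs) (a ∷ c) (b ∷ c′) = begin
  ((a xor b) · g) ⊕ lincomb gs (c ⊕ c′)
    ≡⟨ cong₂ _⊕_ (·-distribʳ-xor a b g) (lincomb-⊕ gs c c′) ⟩
  ((a · g) ⊕ (b · g)) ⊕ (lincomb gs c ⊕ lincomb gs c′)
    ≡⟨ ⊕-interchange (a · g) _ _ _ ⟩
  ((a · g) ⊕ lincomb gs c) ⊕ ((b · g) ⊕ lincomb gs c′) ∎
  where open ≡-Reasoning

Independent : Vec (Vec2 k) j → Set
Independent gs = ∀ c → lincomb gs c ≡ zeroV → c ≡ zeroV

lincomb-injective : ∀ {gs : Vec (Vec2 k) j} → Independent gs → ∀ {c c′} → lincomb gs c ≡ lincomb gs c′ → c ≡ c′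
lincomb-injective {gs = gs} indep {c} {c′} eq = ⊕≡zeroV⇒≡ (indep (c ⊕ c′) (begin
  lincomb gs (c ⊕ c′)              ≡⟨ lincomb-⊕ gs c c′ ⟩
  lincomb gs c ⊕ lincomb gs c′     ≡⟨ cong (_⊕ lincomb gs c′) eq ⟩
  lincomb gs c′ ⊕ lincomb gs c′    ≡⟨ ⊕-same _ ⟩
  zeroV                            ∎))
  where open ≡-Reasoning

_∈Span_ : Vec2 k → Vec (Vec2 k) j → Set
_∈Span_ {j = j} x gs = Σ (Vec2 j) λ c → lincomb gs c ≡ x

_∈Span?_ : ∀ (x : Vec2 k) (gs : Vec (Vec2 k) j) → Dec (x ∈Span gs)
x ∈Span? []       = map′ ([] ,_) (λ { ([] , 0≡x) → 0≡x }) (zeroV ≟ᵥ x)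
x ∈Span? (g ∷ gs) with x ∈Span? gs | (g ⊕ x) ∈Span? gs
... | yes (c , c↦x) | _ = yes (false ∷ c , trans (⊕-identityˡ _) c↦x)
... | no _ | yes (c , c↦g⊕x) = yes (true ∷ c , trans (cong (g ⊕_) c↦g⊕x) (⊕-cancelˡ g x))
... | no x∉ | no g⊕x∉ = no λ
  { (false ∷ c , c↦x) → x∉ (c , trans (sym (⊕-identityˡ _)) c↦x)
  ; (true  ∷ c , c↦x) → g⊕x∉ (c , trans (sym (⊕-cancelˡ g _)) (cong (g ⊕_) c↦x))
  }

Independent-∷ : ∀ {x} {gs : Vec (Vec2 k) j} → Independent gs → ¬ (x ∈Span gs) → Independent (x ∷ gs)
Independent-∷ indep x∉ (false ∷ c) c↦0 = cong (false ∷_) (indep c (trans (sym (⊕-identityˡ _)) c↦0))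
Independent-∷ indep x∉ (true  ∷ c) c↦0 = ⊥-elim (x∉ (c , sym (⊕≡zeroV⇒≡ c↦0)))

spanMult : (Vec2 k → ℕ) → Vec (Vec2 k) j → ℕ
spanMult f gs = sumV (λ c → f (lincomb gs c))

cosetMult : (Vec2 k → ℕ) → Vec (Vec2 k) j → Vec2 k → ℕ
cosetMult f gs x = sumV (λ c → f (x ⊕ lincomb gs c))

representations : Vec (Vec2 k) j → Vec2 k → ℕ
representations gs x = sumV (λ c → δ (lincomb gs c) x)

spanMult-∷ : ∀ (f : Vec2 k → ℕ) x (gs : Vec (Vec2 k) j) → spanMult f (x ∷ gs) ≡ spanMult f gs + cosetMult f gs x
spanMult-∷ {j = j} f x gs =
  trans (sumV-suc {j} (λ c → f (lincomb (x ∷ gs) c)))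
        (cong (_+ cosetMult f gs x) (sumV-cong {j} (λ c → cong f (⊕-identityˡ (lincomb gs c)))))

cosetMult-∈ : ∀ (f : Vec2 k → ℕ) (gs : Vec (Vec2 k) j) c₀ → cosetMult f gs (lincomb gs c₀) ≡ spanMult f gs
cosetMult-∈ f gs c₀ = trans (sumV-cong (λ c → cong f (sym (lincomb-⊕ gs c₀ c)))) (sumV-shift c₀ (f ∘ lincomb gs))

representations-∈ : ∀ (gs : Vec (Vec2 k) j) → Independent gs → ∀ c₀ → representations gs (lincomb gs c₀) ≡ 1
representations-∈ {j = j} gs indep c₀ = trans (sumV-cong {j} δ-lincomb) (sumV-δ c₀)
  where
  δ-lincomb : ∀ c → δ (lincomb gs c) (lincomb gs c₀) ≡ δ c c₀
  δ-lincomb c with c ≟ᵥ c₀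
  ... | yes c≡c₀ = δ-≡ (cong (lincomb gs) c≡c₀)
  ... | no c≢c₀  = δ-≢ (c≢c₀ ∘ lincomb-injective {gs = gs} indep)

representations-∉ : ∀ (gs : Vec (Vec2 k) j) {x} → ¬ (x ∈Span gs) → representations gs x ≡ 0
representations-∉ {j = j} gs x∉ = trans (sumV-cong (λ c → δ-≢ (λ c↦x → x∉ (c , c↦x)))) (sumV-zero j)

representations-≤1 : ∀ (gs : Vec (Vec2 k) j) → Independent gs → ∀ x → representations gs x ≤ 1
representations-≤1 gs indep x with x ∈Span? gs
... | yes (c₀ , refl) = ≤-reflexive (representations-∈ gs indep c₀)
... | no x∉           = subst (_≤ 1) (sym (representations-∉ gs x∉)) z≤n

sumV-cosetMult : ∀ (f : Vec2 k → ℕ) (gs : Vec (Vec2 k) j) → sumV (cosetMult f gs) ≡ 2 ^ j * sumV f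
sumV-cosetMult {j = j} f gs = begin
  sumV (cosetMult f gs)                              ≡⟨ sumV-comm (λ x c → f (x ⊕ lincomb gs c)) ⟩
  sumV (λ c → sumV (λ x → f (x ⊕ lincomb gs c)))
    ≡⟨ sumV-cong {j} (λ c → trans (sumV-cong (λ x → cong f (⊕-comm x (lincomb gs c)))) (sumV-shift _ f)) ⟩
  sumV {j} (λ _ → sumV f)                            ≡⟨ sumV-const j _ ⟩
  2 ^ j * sumV f                                     ∎
  where open ≡-Reasoning

sumV-representations : ∀ (gs : Vec (Vec2 k) j) → sumV (representations gs) ≡ 2 ^ j
sumV-representations {j = j} gs = begin
  sumV (representations gs)                          ≡⟨ sumV-comm (λ x c → δ (lincomb gs c) x) ⟩
  sumV (λ c → sumV (λ x → δ (lincomb gs c) x))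
    ≡⟨ sumV-cong {j} (λ c → trans (sumV-cong (δ-comm (lincomb gs c))) (sumV-δ (lincomb gs c))) ⟩
  sumV {j} (λ _ → 1)                                 ≡⟨ sumV-const j 1 ⟩
  2 ^ j * 1                                          ≡⟨ *-identityʳ _ ⟩
  2 ^ j                                              ∎
  where open ≡-Reasoning

averaging-pointwise : ∀ (f : Vec2 k → ℕ) (gs : Vec (Vec2 k) j) {c w} → Independent gs →
  (∀ x → ¬ (x ∈Span gs) → spanMult f (x ∷ gs) + c ≤ w) →
  ∀ x → cosetMult f gs x + (spanMult f gs + c) + w * representations gs x
        ≤ w + (spanMult f gs + (spanMult f gs + c)) * representations gs x
averaging-pointwise f gs {c} {w} indep bound x with x ∈Span? gs
... | yes (c₀ , refl) rewrite cosetMult-∈ f gs c₀ | representations-∈ gs indep c₀ =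
  ≤-reflexive (swap-units (spanMult f gs + (spanMult f gs + c)) w)
  where
  swap-units : ∀ a w → a + w * 1 ≡ w + a * 1
  swap-units = solve-∀
... | no x∉ rewrite representations-∉ gs x∉ = begin
  cosetMult f gs x + (spanMult f gs + c) + w * 0   ≡⟨ rearrange (cosetMult f gs x) (spanMult f gs) c w ⟩
  spanMult f gs + cosetMult f gs x + c             ≡⟨ cong (_+ c) (spanMult-∷ f x gs) ⟨
  spanMult f (x ∷ gs) + c                          ≤⟨ bound x x∉ ⟩
  w                                                ≡⟨ pad w (spanMult f gs + (spanMult f gs + c)) ⟩
  w + (spanMult f gs + (spanMult f gs + c)) * 0    ∎
  where
  open ≤-Reasoning
  rearrange : ∀ a U c w → a + (U + c) + w * 0 ≡ U + a + c
  rearrange = solve-∀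
  pad : ∀ w a → w ≡ w + a * 0
  pad = solve-∀

-- The sum over all x of the bound for the span of gs and x.  For the 2 ^ j vectors x in the
-- span of gs, x adds nothing to the span and cosetMult counts spanMult f gs a second time.
averaging : ∀ (f : Vec2 k → ℕ) (gs : Vec (Vec2 k) j) {c w} → Independent gs →
  (∀ x → ¬ (x ∈Span gs) → spanMult f (x ∷ gs) + c ≤ w) →
  2 ^ j * sumV f + 2 ^ k * (spanMult f gs + c) + w * 2 ^ j ≤ 2 ^ k * w + (spanMult f gs + (spanMult f gs + c)) * 2 ^ j
averaging {k} {j} f gs {c} {w} indep bound = begin
  2 ^ j * sumV f + 2 ^ k * s + w * 2 ^ j
    ≡⟨ cong₂ (λ a b → a + 2 ^ k * s + w * b) (sumV-cosetMult f gs) (sumV-representations gs) ⟨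
  sumV (cosetMult f gs) + 2 ^ k * s + w * sumV (representations gs)
    ≡⟨ cong₂ _+_ (trans (sumV-+ (cosetMult f gs) (λ _ → s)) (cong (sumV (cosetMult f gs) +_) (sumV-const k s)))
                 (sumV-* w (representations gs)) ⟨
  sumV (λ x → cosetMult f gs x + s) + sumV (λ x → w * representations gs x)
    ≡⟨ sumV-+ (λ x → cosetMult f gs x + s) _ ⟨
  sumV (λ x → cosetMult f gs x + s + w * representations gs x)
    ≤⟨ sumV-≤ (averaging-pointwise f gs indep bound) ⟩
  sumV (λ x → w + (U + s) * representations gs x)
    ≡⟨ sumV-+ {k} (λ _ → w) _ ⟩
  sumV {k} (λ _ → w) + sumV (λ x → (U + s) * representations gs x)
    ≡⟨ cong₂ _+_ (sumV-const k w) (trans (sumV-* (U + s) (representations gs)) (cong ((U + s) *_) (sumV-representations gs))) ⟩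
  2 ^ k * w + (U + s) * 2 ^ j ∎
  where
  open ≤-Reasoning
  U = spanMult f gs
  s = U + c

comb : Vec2 k → Vec2 k → Vec2 k → Bool × Bool × Bool → Vec2 k
comb u₁ u₂ u₃ (a , b , c) = ((a · u₁) ⊕ (b · u₂)) ⊕ (c · u₃)

planeMult-≤ : ∀ {M N : Multiset k} → (∀ x → M x ≤ N x) →
  ∀ u₁ u₂ u₃ → planeMult M u₁ u₂ u₃ ≤ planeMult N u₁ u₂ u₃
planeMult-≤ M≤N u₁ u₂ u₃ = sum-map-≤ (M≤N ∘ comb u₁ u₂ u₃) nonzeroTriples

lincomb₃ : ∀ (u₁ u₂ u₃ : Vec2 k) a b c →
  lincomb (u₁ ∷ u₂ ∷ u₃ ∷ []) (a ∷ b ∷ c ∷ []) ≡ comb u₁ u₂ u₃ (a , b , c)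
lincomb₃ u₁ u₂ u₃ a b c =
  trans (cong (λ v → (a · u₁) ⊕ ((b · u₂) ⊕ v)) (⊕-identityʳ (c · u₃))) (sym (⊕-assoc (a · u₁) _ _))

Independent⇒LinIndep3 : ∀ {u₁ u₂ u₃ : Vec2 k} → Independent (u₁ ∷ u₂ ∷ u₃ ∷ []) → LinIndep3 u₁ u₂ u₃
Independent⇒LinIndep3 {u₁ = u₁} {u₂} {u₃} indep a b c abc↦0
  with indep (a ∷ b ∷ c ∷ []) (trans (lincomb₃ u₁ u₂ u₃ a b c) abc↦0)
... | refl = refl , refl , refl

LinIndep3⇒Independent : ∀ {u₁ u₂ u₃ : Vec2 k} → LinIndep3 u₁ u₂ u₃ → Independent (u₁ ∷ u₂ ∷ u₃ ∷ [])
LinIndep3⇒Independent {u₁ = u₁} {u₂} {u₃} indep (a ∷ b ∷ c ∷ []) abc↦0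
  with indep a b c (trans (sym (lincomb₃ u₁ u₂ u₃ a b c)) abc↦0)
... | refl , refl , refl = refl

spanMult-plane : ∀ (f : Vec2 k → ℕ) u₁ u₂ u₃ →
  spanMult f (u₁ ∷ u₂ ∷ u₃ ∷ []) ≡ f zeroV + planeMult f u₁ u₂ u₃
spanMult-plane f u₁ u₂ u₃ = begin
  spanMult f (u₁ ∷ u₂ ∷ u₃ ∷ [])
    ≡⟨ sumV-cong {f = f ∘ lincomb (u₁ ∷ u₂ ∷ u₃ ∷ [])} {g = f ∘ q}
                 (λ { (a ∷ b ∷ c ∷ []) → cong f (lincomb₃ u₁ u₂ u₃ a b c) }) ⟩
  sumV (f ∘ q)
    ≡⟨ reorder (f (p false false false)) (f (p false false true)) (f (p false true false)) (f (p false true true))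
               (f (p true false false)) (f (p true false true)) (f (p true true false)) (f (p true true true)) ⟩
  f (p false false false) + planeMult f u₁ u₂ u₃
    ≡⟨ cong (λ v → f v + planeMult f u₁ u₂ u₃) (trans (⊕-identityʳ _) (⊕-identityˡ zeroV)) ⟩
  f zeroV + planeMult f u₁ u₂ u₃ ∎
  where
  open ≡-Reasoning
  p : Bool → Bool → Bool → Vec2 _
  p a b c = comb u₁ u₂ u₃ (a , b , c)
  q : Vec2 3 → Vec2 _
  q (a ∷ b ∷ c ∷ []) = p a b c
  reorder : ∀ z x₁ x₂ x₃ x₄ x₅ x₆ x₇ →
    z + (x₁ + (x₂ + (x₃ + (x₄ + (x₅ + (x₆ + (x₇ + 0)))))))
      ≡ z + (x₄ + (x₂ + (x₆ + (x₁ + (x₅ + (x₃ + (x₇ + 0)))))))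
  reorder = solve-∀

-- The Griesmer upper bound

slack : ∀ G {U c w d} → 1 ≤ G → (w + d) + (G + 2) * (U + c) + w ≤ (G + 2) * w + (U + (U + c)) →
  Σ ℕ λ t → w ≡ U + c + t × c + d ≤ G * t
slack G {U} {c} {w} {d} 1≤G averaged = w ∸ s , w≡s+t , c+d≤Gt
  where
  open ≤-Reasoning
  s = U + c
  s≤w : s ≤ w
  s≤w = *-cancelˡ-≤ G {{>-nonZero 1≤G}} (+-cancelʳ-≤ (2 * s + 2 * w) _ _ (begin
    G * s + (2 * s + 2 * w)       ≡⟨ regroupˡ G s w ⟩
    (G + 2) * s + 2 * w           ≤⟨ +-monoʳ-≤ ((G + 2) * s) (m≤n+m (2 * w) d) ⟩
    (G + 2) * s + (d + 2 * w)     ≡⟨ regroup (G + 2) s d w ⟩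
    (w + d) + (G + 2) * s + w     ≤⟨ averaged ⟩
    (G + 2) * w + (U + s)         ≤⟨ +-monoʳ-≤ ((G + 2) * w) (+-monoˡ-≤ s (m≤m+n U c)) ⟩
    (G + 2) * w + (s + s)         ≡⟨ regroupʳ G s w ⟩
    G * w + (2 * s + 2 * w)       ∎))
    where
    regroupˡ : ∀ G s w → G * s + (2 * s + 2 * w) ≡ (G + 2) * s + 2 * w
    regroupˡ = solve-∀
    regroup : ∀ a s d w → a * s + (d + 2 * w) ≡ (w + d) + a * s + w
    regroup = solve-∀
    regroupʳ : ∀ G s w → (G + 2) * w + (s + s) ≡ G * w + (2 * s + 2 * w)
    regroupʳ = solve-∀
  w≡s+t : w ≡ s + (w ∸ s)
  w≡s+t = sym (m+[n∸m]≡n s≤w)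
  c+d≤Gt : c + d ≤ G * (w ∸ s)
  c+d≤Gt = +-cancelˡ-≤ ((G + 2) * s + U + s + 2 * t) _ _ (begin
    (G + 2) * s + U + s + 2 * t + (c + d)   ≡⟨ regroupˡ (G + 2) U c d t ⟩
    (s + t + d) + (G + 2) * s + (s + t)     ≡⟨ cong (λ v → (v + d) + (G + 2) * s + v) w≡s+t ⟨
    (w + d) + (G + 2) * s + w               ≤⟨ averaged ⟩
    (G + 2) * w + (U + s)                   ≡⟨ cong (λ v → (G + 2) * v + (U + s)) w≡s+t ⟩
    (G + 2) * (s + t) + (U + s)             ≡⟨ regroupʳ G U c t ⟩
    (G + 2) * s + U + s + 2 * t + G * t     ∎)
    where
    t = w ∸ s
    regroupˡ : ∀ a U c d t → a * (U + c) + U + (U + c) + 2 * t + (c + d) ≡ ((U + c) + t + d) + a * (U + c) + ((U + c) + t)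
    regroupˡ = solve-∀
    regroupʳ : ∀ G U c t → (G + 2) * ((U + c) + t) + (U + (U + c)) ≡ (G + 2) * (U + c) + U + (U + c) + 2 * t + G * t
    regroupʳ = solve-∀

trade : ∀ A B {c d t} → 1 ≤ A + B → B * d ≤ A * c → c + d ≤ 2 * (A + B) * t → d ≤ 2 * A * t
trade A B {c} {d} {t} 1≤A+B Bd≤Ac c+d≤ = *-cancelˡ-≤ (A + B) {{>-nonZero 1≤A+B}} (begin
  (A + B) * d           ≡⟨ *-distribʳ-+ d A B ⟩
  A * d + B * d         ≤⟨ +-monoʳ-≤ (A * d) Bd≤Ac ⟩
  A * d + A * c         ≡⟨ trans (sym (*-distribˡ-+ A d c)) (cong (A *_) (+-comm d c)) ⟩
  A * (c + d)           ≤⟨ *-monoʳ-≤ A c+d≤ ⟩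
  A * (2 * (A + B) * t) ≡⟨ reassociate A B t ⟩
  (A + B) * (2 * A * t) ∎)
  where
  open ≤-Reasoning
  reassociate : ∀ A B t → A * (2 * (A + B) * t) ≡ (A + B) * (2 * A * t)
  reassociate = solve-∀

descent-arithmetic : ∀ A B {m U c w d} → 1 ≤ A → 1 ≤ m → B * d ≤ A * c →
  m * (w + d) + m * (2 * (A + B) + 2) * (U + c) + w * m ≤ m * (2 * (A + B) + 2) * w + (U + (U + c)) * m →
  U + (c + ceilDiv d (2 * A)) ≤ w
descent-arithmetic A B {m} {U} {c} {w} {d} 1≤A 1≤m Bd≤Ac summed = conclude (slack (2 * (A + B)) 1≤G averaged)
  where
  open ≤-Reasoning
  1≤A+B : 1 ≤ A + B
  1≤A+B = ≤-trans 1≤A (m≤m+n A B)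
  1≤G : 1 ≤ 2 * (A + B)
  1≤G = ≤-trans 1≤A+B (m≤m+n (A + B) _)
  1≤2A : 1 ≤ 2 * A
  1≤2A = ≤-trans 1≤A (m≤m+n A _)
  averaged : (w + d) + (2 * (A + B) + 2) * (U + c) + w ≤ (2 * (A + B) + 2) * w + (U + (U + c))
  averaged = *-cancelˡ-≤ m {{>-nonZero 1≤m}}
    (subst₂ _≤_ (factorˡ m w d (2 * (A + B) + 2) (U + c)) (factorʳ m w (2 * (A + B) + 2) U (U + c)) summed)
    where
    factorˡ : ∀ m w d H s → m * (w + d) + m * H * s + w * m ≡ m * ((w + d) + H * s + w)
    factorˡ = solve-∀
    factorʳ : ∀ m w H U s → m * H * w + (U + s) * m ≡ m * (H * w + (U + s))
    factorʳ = solve-∀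
  conclude : Σ ℕ (λ t → w ≡ U + c + t × c + d ≤ 2 * (A + B) * t) → U + (c + ceilDiv d (2 * A)) ≤ w
  conclude (t , w≡s+t , c+d≤Gt) = begin
    U + (c + ceilDiv d (2 * A)) ≡⟨ +-assoc U c _ ⟨
    U + c + ceilDiv d (2 * A)   ≤⟨ +-monoʳ-≤ (U + c) (ceilDiv-least 1≤2A (trade A B 1≤A+B Bd≤Ac c+d≤Gt)) ⟩
    U + c + t                   ≡⟨ w≡s+t ⟨
    w                           ∎

-- In the Griesmer descent A = 2^(2-j) V and B = 2^(2-j) - 1, so that 2^k = 2^j (2(A + B) + 2);
-- c collects the earlier ceilings, and B/A = 1/2V + … + 1/(2^(2-j) V) gives B * d ≤ A * c.
descent : ∀ (f : Vec2 k → ℕ) A B {c w d} → 2 ^ k ≡ 2 ^ j * (2 * (A + B) + 2) → 1 ≤ A → B * d ≤ A * c →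
  sumV f ≡ w + d →
  (∀ (gs : Vec (Vec2 k) (suc j)) → Independent gs → spanMult f gs + c ≤ w) →
  ∀ (gs : Vec (Vec2 k) j) → Independent gs → spanMult f gs + (c + ceilDiv d (2 * A)) ≤ w
descent {k} {j} f A B {c} {w} {d} 2^k≡ 1≤A Bd≤Ac n≡w+d bound gs indep =
  descent-arithmetic A B 1≤A (m^n>0 2 j) Bd≤Ac
    (subst₂ (λ n K → 2 ^ j * n + K * s + w * 2 ^ j ≤ K * w + (U + s) * 2 ^ j) n≡w+d 2^k≡
      (averaging f gs indep (λ x x∉ → bound (x ∷ gs) (Independent-∷ indep x∉))))
  where
  U = spanMult f gs
  s = U + c

PlaneBounded⇒spanMult≤ : ∀ (M : Multiset k) {w} → PlaneBounded M w →
  ∀ (gs : Vec (Vec2 k) 3) → Independent gs → spanMult (onPoints M) gs + 0 ≤ w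
PlaneBounded⇒spanMult≤ M {w} bounded (u₁ ∷ u₂ ∷ u₃ ∷ []) indep = begin
  spanMult (onPoints M) (u₁ ∷ u₂ ∷ u₃ ∷ []) + 0             ≡⟨ +-identityʳ _ ⟩
  spanMult (onPoints M) (u₁ ∷ u₂ ∷ u₃ ∷ [])                 ≡⟨ spanMult-plane (onPoints M) u₁ u₂ u₃ ⟩
  onPoints M zeroV + planeMult (onPoints M) u₁ u₂ u₃
    ≡⟨ cong (_+ planeMult (onPoints M) u₁ u₂ u₃) (onPoints-zeroV M) ⟩
  planeMult (onPoints M) u₁ u₂ u₃                           ≤⟨ planeMult-≤ (onPoints-≤ M) u₁ u₂ u₃ ⟩
  planeMult M u₁ u₂ u₃                                      ≤⟨ bounded u₁ u₂ u₃ (Independent⇒LinIndep3 indep) ⟩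
  w                                                         ∎
  where open ≤-Reasoning

3d≤4V[⌈d/2V⌉+⌈d/4V⌉] : ∀ d {V} → 1 ≤ V → 3 * d ≤ 4 * V * (ceilDiv d (2 * V) + ceilDiv d (2 * (2 * V)))
3d≤4V[⌈d/2V⌉+⌈d/4V⌉] d {V} 1≤V = begin
  3 * d                                ≡⟨ split d ⟩
  2 * d + d                            ≤⟨ +-mono-≤ (*-monoʳ-≤ 2 (≤*ceilDiv d 1≤2V)) (≤*ceilDiv d 1≤4V) ⟩
  2 * (2 * V * a₁) + 2 * (2 * V) * a₂  ≡⟨ merge V a₁ a₂ ⟩
  4 * V * (a₁ + a₂)                    ∎
  where
  open ≤-Reasoning
  a₁ = ceilDiv d (2 * V)
  a₂ = ceilDiv d (2 * (2 * V))
  1≤2V : 1 ≤ 2 * V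
  1≤2V = ≤-trans 1≤V (m≤m+n V _)
  1≤4V : 1 ≤ 2 * (2 * V)
  1≤4V = ≤-trans 1≤2V (m≤m+n _ _)
  split : ∀ d → 3 * d ≡ 2 * d + d
  split = solve-∀
  merge : ∀ V a b → 2 * (2 * V * a) + 2 * (2 * V) * b ≡ 4 * V * (a + b)
  merge = solve-∀

griesmerExcess : ℕ → ℕ → ℕ
griesmerExcess V d = ceilDiv d (2 * V) + ceilDiv d (4 * V) + ceilDiv d (8 * V)

griesmer-upper-bound : ∀ (M : Multiset k) {w V} → 1 ≤ V → 2 ^ k ≡ 8 * V + 8 → PlaneBounded M w → w ≤ total M →
  griesmerExcess V (total M ∸ w) ≤ w
griesmer-upper-bound {k} M {w} {V} 1≤V 2^k≡8V+8 bounded w≤n = begin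
  griesmerExcess V d
    ≡⟨ cong₂ (λ x y → a₁ + x + y) (cong (ceilDiv d) (*-assoc 2 2 V)) (cong (ceilDiv d) (*-assoc 2 4 V)) ⟩
  a₁ + a₂ + a₃
    ≡⟨ cong (_+ (a₁ + a₂ + a₃)) (trans (+-identityʳ (f zeroV)) (onPoints-zeroV M)) ⟨
  spanMult f [] + (a₁ + a₂ + a₃)
    ≤⟨ origin [] (λ { [] _ → refl }) ⟩
  w ∎
  where
  open ≤-Reasoning
  f = onPoints M
  d = total M ∸ w
  a₁ = ceilDiv d (2 * V)
  a₂ = ceilDiv d (2 * (2 * V))
  a₃ = ceilDiv d (2 * (4 * V))
  n≡w+d : sumV f ≡ w + d
  n≡w+d = sym (m+[n∸m]≡n w≤n)
  1≤2V : 1 ≤ 2 * V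
  1≤2V = ≤-trans 1≤V (m≤m+n V _)
  lines : ∀ (gs : Vec (Vec2 k) 2) → Independent gs → spanMult f gs + a₁ ≤ w
  lines = descent f V 0 (trans 2^k≡8V+8 (factor V)) 1≤V z≤n n≡w+d (PlaneBounded⇒spanMult≤ M bounded)
    where
    factor : ∀ V → 8 * V + 8 ≡ 4 * (2 * (V + 0) + 2)
    factor = solve-∀
  points : ∀ (gs : Vec (Vec2 k) 1) → Independent gs → spanMult f gs + (a₁ + a₂) ≤ w
  points = descent f (2 * V) 1 (trans 2^k≡8V+8 (factor V)) 1≤2V
    (≤-trans (≤-reflexive (*-identityˡ d)) (≤*ceilDiv d 1≤2V)) n≡w+d lines
    where
    factor : ∀ V → 8 * V + 8 ≡ 2 * (2 * (2 * V + 1) + 2)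
    factor = solve-∀
  origin : ∀ (gs : Vec (Vec2 k) 0) → Independent gs → spanMult f gs + (a₁ + a₂ + a₃) ≤ w
  origin = descent f (4 * V) 3 (trans 2^k≡8V+8 (factor V)) (≤-trans 1≤V (m≤m+n V _))
    (3d≤4V[⌈d/2V⌉+⌈d/4V⌉] d 1≤V) n≡w+d points
    where
    factor : ∀ V → 8 * V + 8 ≡ 1 * (2 * (4 * V + 3) + 2)
    factor = solve-∀

-- Constructions

_⊞_ : Multiset k → Multiset k → Multiset k
(M ⊞ N) x = M x + N x

_⊙_ : ℕ → Multiset k → Multiset k
(c ⊙ M) x = c * M x

infixl 6 _⊞_
infixl 7 _⊙_

planeMult-cong : ∀ {M N : Multiset k} → (∀ x → M x ≡ N x) →
  ∀ u₁ u₂ u₃ → planeMult M u₁ u₂ u₃ ≡ planeMult N u₁ u₂ u₃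
planeMult-cong M≗N u₁ u₂ u₃ = cong sum (map-cong (M≗N ∘ comb u₁ u₂ u₃) nonzeroTriples)

planeMult-⊞ : ∀ (M N : Multiset k) u₁ u₂ u₃ →
  planeMult (M ⊞ N) u₁ u₂ u₃ ≡ planeMult M u₁ u₂ u₃ + planeMult N u₁ u₂ u₃
planeMult-⊞ M N u₁ u₂ u₃ = sum-map-+ (M ∘ comb u₁ u₂ u₃) (N ∘ comb u₁ u₂ u₃) nonzeroTriples

planeMult-⊙ : ∀ c (M : Multiset k) u₁ u₂ u₃ → planeMult (c ⊙ M) u₁ u₂ u₃ ≡ c * planeMult M u₁ u₂ u₃
planeMult-⊙ c M u₁ u₂ u₃ = sum-map-* c (M ∘ comb u₁ u₂ u₃) nonzeroTriples

PlaneBounded-⊞ : ∀ (M N : Multiset k) {a b} → PlaneBounded M a → PlaneBounded N b → PlaneBounded (M ⊞ N) (a + b)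
PlaneBounded-⊞ M N {a} {b} boundM boundN u₁ u₂ u₃ indep =
  subst (_≤ a + b) (sym (planeMult-⊞ M N u₁ u₂ u₃)) (+-mono-≤ (boundM u₁ u₂ u₃ indep) (boundN u₁ u₂ u₃ indep))

PlaneBounded-⊙ : ∀ c (M : Multiset k) {a} → PlaneBounded M a → PlaneBounded (c ⊙ M) (c * a)
PlaneBounded-⊙ c M {a} boundM u₁ u₂ u₃ indep =
  subst (_≤ c * a) (sym (planeMult-⊙ c M u₁ u₂ u₃)) (*-monoʳ-≤ c (boundM u₁ u₂ u₃ indep))

total-⊞ : ∀ (M N : Multiset k) → total (M ⊞ N) ≡ total M + total N
total-⊞ M N = trans (sumV-cong onPoints-⊞) (sumV-+ (onPoints M) (onPoints N))
  where
  onPoints-⊞ : ∀ x → onPoints (M ⊞ N) x ≡ onPoints M x + onPoints N x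
  onPoints-⊞ x with isZeroV x
  ... | true  = refl
  ... | false = refl

total-⊙ : ∀ c (M : Multiset k) → total (c ⊙ M) ≡ c * total M
total-⊙ c M = trans (sumV-cong onPoints-⊙) (sumV-* c (onPoints M))
  where
  onPoints-⊙ : ∀ x → onPoints (c ⊙ M) x ≡ c * onPoints M x
  onPoints-⊙ x with isZeroV x
  ... | true  = sym (*-zeroʳ c)
  ... | false = refl

wholeSpace : Multiset k
wholeSpace _ = 1

wholeSpace-planeBounded : PlaneBounded (wholeSpace {k}) 7
wholeSpace-planeBounded _ _ _ _ = ≤-refl

total-wholeSpace : ∀ k → total (wholeSpace {k}) + 1 ≡ 2 ^ k
total-wholeSpace k = trans (total+zeroV (wholeSpace {k})) (trans (sumV-const k 1) (*-identityʳ (2 ^ k)))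

fromBool : Bool → ℕ
fromBool b = if b then 1 else 0

Linear : (Vec2 k → Bool) → Set
Linear φ = ∀ x y → φ (x ⊕ y) ≡ φ x xor φ y

dot : Vec Bool j → Vec Bool j → Bool
dot []       []      = false
dot (p ∷ ps) (b ∷ c) = (b ∧ p) xor dot ps c

halfSpace-count : ∀ (ps : Vec Bool 3) → sumV (λ c → fromBool (dot ps c)) ≤ 4
halfSpace-count (false ∷ false ∷ false ∷ []) = z≤n
halfSpace-count (false ∷ false ∷ true  ∷ []) = ≤-refl
halfSpace-count (false ∷ true  ∷ false ∷ []) = ≤-refl
halfSpace-count (false ∷ true  ∷ true  ∷ []) = ≤-refl
halfSpace-count (true  ∷ false ∷ false ∷ []) = ≤-refl
halfSpace-count (true  ∷ false ∷ true  ∷ []) = ≤-refl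
halfSpace-count (true  ∷ true  ∷ false ∷ []) = ≤-refl
halfSpace-count (true  ∷ true  ∷ true  ∷ []) = ≤-refl

offKernel : (Vec2 k → Bool) → Multiset k
offKernel φ = fromBool ∘ φ

module _ (φ : Vec2 k → Bool) (linear : Linear φ) where

  linear-zeroV : φ zeroV ≡ false
  linear-zeroV = trans (cong φ (sym (⊕-identityˡ zeroV))) (trans (linear zeroV zeroV) (xor-same (φ zeroV)))

  linear-lincomb : ∀ (gs : Vec (Vec2 k) j) c → φ (lincomb gs c) ≡ dot (Vec.map φ gs) c
  linear-lincomb []       []      = linear-zeroV
  linear-lincomb (g ∷ gs) (b ∷ c) = trans (linear (b · g) (lincomb gs c)) (cong₂ _xor_ (scale b) (linear-lincomb gs c))
    where
    scale : ∀ b → φ (b · g) ≡ b ∧ φ g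
    scale true  = refl
    scale false = linear-zeroV

  offKernel-planeBounded : PlaneBounded (offKernel φ) 4
  offKernel-planeBounded u₁ u₂ u₃ _ = begin
    planeMult (offKernel φ) u₁ u₂ u₃                          ≤⟨ m≤n+m _ (offKernel φ zeroV) ⟩
    offKernel φ zeroV + planeMult (offKernel φ) u₁ u₂ u₃      ≡⟨ spanMult-plane (offKernel φ) u₁ u₂ u₃ ⟨
    spanMult (offKernel φ) gs                                 ≡⟨ sumV-cong (cong fromBool ∘ linear-lincomb gs) ⟩
    sumV (λ c → fromBool (dot (Vec.map φ gs) c))              ≤⟨ halfSpace-count (Vec.map φ gs) ⟩
    4                                                         ∎
    where
    open ≤-Reasoning
    gs = u₁ ∷ u₂ ∷ u₃ ∷ []

firstCoordinate : Vec2 (suc k) → Bool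
firstCoordinate (a ∷ _) = a

firstCoordinate-linear : Linear (firstCoordinate {k})
firstCoordinate-linear (a ∷ _) (b ∷ _) = refl

offHyperplane : Multiset (suc k)
offHyperplane = offKernel firstCoordinate

total-offHyperplane : ∀ k → total (offHyperplane {k}) ≡ 2 ^ k
total-offHyperplane k = begin
  total (offHyperplane {k})                 ≡⟨ total-vanishing (offHyperplane {k}) refl ⟩
  sumV (offHyperplane {k})                  ≡⟨ sumV-suc (offHyperplane {k}) ⟩
  sumV {k} (λ _ → 0) + sumV {k} (λ _ → 1)   ≡⟨ cong₂ _+_ (sumV-zero k) (sumV-const k 1) ⟩
  2 ^ k * 1                                 ≡⟨ *-identityʳ (2 ^ k) ⟩
  2 ^ k                                     ∎
  where open ≡-Reasoning

offCodim2 : Multiset (suc (suc k))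
offCodim2 (a ∷ b ∷ _) = fromBool (a ∨ b)

-- Twice the complement of a codimension-2 subspace is the sum of the complements of the three
-- hyperplanes containing it.
offCodim2-planeBounded : PlaneBounded (offCodim2 {k}) 6
offCodim2-planeBounded u₁ u₂ u₃ indep = *-cancelˡ-≤ 2 (begin
  2 * planeMult offCodim2 u₁ u₂ u₃    ≡⟨ planeMult-⊙ 2 offCodim2 u₁ u₂ u₃ ⟨
  planeMult (2 ⊙ offCodim2) u₁ u₂ u₃  ≡⟨ planeMult-cong double u₁ u₂ u₃ ⟩
  planeMult (H₁ ⊞ H₂ ⊞ H₃) u₁ u₂ u₃   ≤⟨ PlaneBounded-⊞ (H₁ ⊞ H₂) H₃
                                          (PlaneBounded-⊞ H₁ H₂ (offKernel-planeBounded firstCoordinate firstCoordinate-linear)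
                                                                (offKernel-planeBounded φ₂ φ₂-linear))
                                          (offKernel-planeBounded φ₃ φ₃-linear) u₁ u₂ u₃ indep ⟩
  2 * 6                               ∎)
  where
  open ≤-Reasoning
  φ₂ φ₃ : Vec2 (suc (suc _)) → Bool
  φ₂ (a ∷ b ∷ _) = b
  φ₃ (a ∷ b ∷ _) = a xor b
  φ₂-linear : Linear φ₂
  φ₂-linear (a ∷ b ∷ _) (a′ ∷ b′ ∷ _) = refl
  φ₃-linear : Linear φ₃
  φ₃-linear (a ∷ b ∷ _) (a′ ∷ b′ ∷ _) = interchange a a′ b b′
  H₁ H₂ H₃ : Multiset _
  H₁ = offKernel firstCoordinate
  H₂ = offKernel φ₂
  H₃ = offKernel φ₃
  double : ∀ x → (2 ⊙ offCodim2) x ≡ (H₁ ⊞ H₂ ⊞ H₃) x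
  double (false ∷ false ∷ _) = refl
  double (false ∷ true  ∷ _) = refl
  double (true  ∷ false ∷ _) = refl
  double (true  ∷ true  ∷ _) = refl

total-offCodim2 : ∀ k → total (offCodim2 {k}) ≡ 3 * 2 ^ k
total-offCodim2 k = begin
  total (offCodim2 {k})          ≡⟨ total-vanishing (offCodim2 {k}) refl ⟩
  sumV (offCodim2 {k})           ≡⟨ sumV-suc (offCodim2 {k}) ⟩
  sumV (λ x → offCodim2 {k} (false ∷ x)) + sumV (λ x → offCodim2 {k} (true ∷ x))
    ≡⟨ cong₂ _+_ (sumV-suc (λ x → offCodim2 {k} (false ∷ x))) (sumV-suc (λ x → offCodim2 {k} (true ∷ x))) ⟩
  (sumV {k} (λ _ → 0) + sumV {k} (λ _ → 1)) + (sumV {k} (λ _ → 1) + sumV {k} (λ _ → 1))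
    ≡⟨ cong₂ _+_ (cong₂ _+_ (sumV-zero k) (sumV-const k 1)) (cong₂ _+_ (sumV-const k 1) (sumV-const k 1)) ⟩
  2 ^ k * 1 + (2 ^ k * 1 + 2 ^ k * 1) ≡⟨ collect (2 ^ k) ⟩
  3 * 2 ^ k                      ∎
  where
  open ≡-Reasoning
  collect : ∀ p → p * 1 + (p * 1 + p * 1) ≡ 3 * p
  collect = solve-∀

pointAt : Vec2 k → Multiset k
pointAt p x = δ x p

pointAt-planeBounded : ∀ (p : Vec2 k) → PlaneBounded (pointAt p) 1
pointAt-planeBounded p u₁ u₂ u₃ indep = begin
  planeMult (pointAt p) u₁ u₂ u₃              ≤⟨ m≤n+m _ (δ zeroV p) ⟩
  δ zeroV p + planeMult (pointAt p) u₁ u₂ u₃  ≡⟨ spanMult-plane (pointAt p) u₁ u₂ u₃ ⟨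
  representations gs p                        ≤⟨ representations-≤1 gs (LinIndep3⇒Independent indep) p ⟩
  1                                           ∎
  where
  open ≤-Reasoning
  gs = u₁ ∷ u₂ ∷ u₃ ∷ []

total-pointAt : ∀ {p : Vec2 k} → p ≢ zeroV → total (pointAt p) ≡ 1
total-pointAt {p = p} p≢0 = trans (total-vanishing (pointAt p) (δ-≢ (p≢0 ∘ sym))) (sumV-δ p)

-- Optimality of the constructions

ceilDiv-scaled : ∀ m h a t V → 1 ≤ m → 1 ≤ V → m * h ≡ 8 → ceilDiv ((8 * a + t) * V) (m * V) ≤ h * a + ceilDiv t m
ceilDiv-scaled m h a t V 1≤m 1≤V mh≡8 = ceilDiv-least (*-mono-≤ 1≤m 1≤V) (begin
  (8 * a + t) * V                   ≤⟨ *-monoˡ-≤ V (+-monoʳ-≤ (8 * a) (≤*ceilDiv t 1≤m)) ⟩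
  (8 * a + m * ceilDiv t m) * V     ≡⟨ cong (λ x → (x * a + m * ceilDiv t m) * V) mh≡8 ⟨
  (m * h * a + m * ceilDiv t m) * V ≡⟨ regroup m h a (ceilDiv t m) V ⟩
  m * V * (h * a + ceilDiv t m)     ∎)
  where
  open ≤-Reasoning
  regroup : ∀ m h a x V → (m * h * a + m * x) * V ≡ m * V * (h * a + x)
  regroup = solve-∀

floorDiv-scaled : ∀ m h a t V {d} .{{_ : NonZero m}} → 1 ≤ V → m * h ≡ 8 → (8 * a + t) * V < d →
  h * a + t / m < ceilDiv d (m * V)
floorDiv-scaled m h a t V {d} 1≤V mh≡8 D<d = <-ceilDiv (*-mono-≤ (>-nonZero⁻¹ m) 1≤V) (begin-strict
  m * V * (h * a + t / m)           ≡⟨ regroup m h a (t / m) V ⟩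
  (m * h * a + t / m * m) * V       ≡⟨ cong (λ x → (x * a + t / m * m) * V) mh≡8 ⟩
  (8 * a + t / m * m) * V           ≤⟨ *-monoˡ-≤ V (+-monoʳ-≤ (8 * a) (m/n*n≤m t m)) ⟩
  (8 * a + t) * V                   <⟨ D<d ⟩
  d                                 ∎)
  where
  open ≤-Reasoning
  regroup : ∀ m h a x V → m * V * (h * a + x) ≡ (m * h * a + x * m) * V
  regroup = solve-∀

floorSum : ℕ → ℕ
floorSum t = t / 2 + t / 4 + t / 8

griesmerExcess-at : ∀ a t {V} → 1 ≤ V → griesmerExcess V ((8 * a + t) * V) ≤ 7 * a + griesmerExcess 1 t
griesmerExcess-at a t {V} 1≤V = begin
  griesmerExcess V ((8 * a + t) * V)
    ≤⟨ +-mono-≤ (+-mono-≤ (ceilDiv-scaled 2 4 a t V (s≤s z≤n) 1≤V refl) (ceilDiv-scaled 4 2 a t V (s≤s z≤n) 1≤V refl))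
                (ceilDiv-scaled 8 1 a t V (s≤s z≤n) 1≤V refl) ⟩
  (4 * a + ceilDiv t 2) + (2 * a + ceilDiv t 4) + (1 * a + ceilDiv t 8)
    ≡⟨ collect a (ceilDiv t 2) (ceilDiv t 4) (ceilDiv t 8) ⟩
  7 * a + griesmerExcess 1 t ∎
  where
  open ≤-Reasoning
  collect : ∀ a x y z → (4 * a + x) + (2 * a + y) + (1 * a + z) ≡ 7 * a + (x + y + z)
  collect = solve-∀

griesmerExcess-beyond : ∀ a t {V d} → 1 ≤ V → (8 * a + t) * V < d → 7 * a + floorSum t + 3 ≤ griesmerExcess V d
griesmerExcess-beyond a t {V} 1≤V D<d = begin
  7 * a + floorSum t + 3
    ≡⟨ spread a (t / 2) (t / 4) (t / 8) ⟩
  suc (4 * a + t / 2) + suc (2 * a + t / 4) + suc (1 * a + t / 8)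
    ≤⟨ +-mono-≤ (+-mono-≤ (floorDiv-scaled 2 4 a t V 1≤V refl D<d) (floorDiv-scaled 4 2 a t V 1≤V refl D<d))
                (floorDiv-scaled 8 1 a t V 1≤V refl D<d) ⟩
  griesmerExcess V _ ∎
  where
  open ≤-Reasoning
  spread : ∀ a x y z → 7 * a + (x + y + z) + 3 ≡ suc (4 * a + x) + suc (2 * a + y) + suc (1 * a + z)
  spread = solve-∀

Griesmer : ℕ → ℕ → ℕ → Set
Griesmer k w n = (w ≤ n) × (g 2 (k ∸ 3) k (n ∸ w) ≤ n)

-- dim = k = 4 + k₀, so that k - 3 reduces to suc k₀.
module Dimension (k₀ : ℕ) where

  dim : ℕ
  dim = 4 + k₀

  V : ℕ
  V = v 2 (suc k₀)

  V+1≡2^[dim-3] : V + 1 ≡ 2 ^ suc k₀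
  V+1≡2^[dim-3] = trans (cong (_+ 1) (n/1≡n (2 ^ suc k₀ ∸ 1))) (m∸n+n≡m (m^n>0 2 (suc k₀)))

  1≤V : 1 ≤ V
  1≤V = +-cancelʳ-≤ 1 1 V (subst (2 ≤_) (sym V+1≡2^[dim-3]) (*-monoʳ-≤ 2 (m^n>0 2 k₀)))

  2^dim≡8V+8 : 2 ^ dim ≡ 8 * V + 8
  2^dim≡8V+8 = trans (cong (λ p → 2 * (2 * (2 * p))) (sym V+1≡2^[dim-3])) (expand V)
    where
    expand : ∀ V → 2 * (2 * (2 * (V + 1))) ≡ 8 * V + 8
    expand = solve-∀

  g≡ : ∀ d → g 2 (dim ∸ 3) dim d ≡ d + griesmerExcess V d
  g≡ d = cong (λ m → d + sumFrom1 m (λ i → ceilDiv d (2 ^ i * V))) (m+n∸n≡m 3 k₀)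

  Griesmer⇒excess≤ : ∀ {w n} → Griesmer dim w n → griesmerExcess V (n ∸ w) ≤ w
  Griesmer⇒excess≤ {w} {n} (w≤n , g≤n) = +-cancelˡ-≤ (n ∸ w) _ _
    (subst₂ _≤_ (g≡ (n ∸ w)) (trans (sym (m+[n∸m]≡n w≤n)) (+-comm w (n ∸ w))) g≤n)

  e₁ : Vec2 dim
  e₁ = true ∷ zeroV

  construction : ℕ → ℕ → ℕ → ℕ → Multiset dim
  construction a q c e = a ⊙ wholeSpace ⊞ q ⊙ offHyperplane ⊞ c ⊙ offCodim2 ⊞ e ⊙ pointAt e₁

  construction-planeBounded : ∀ a q c e → PlaneBounded (construction a q c e) (a * 7 + q * 4 + c * 6 + e * 1)
  construction-planeBounded a q c e =
    PlaneBounded-⊞ (W ⊞ H ⊞ C) P (PlaneBounded-⊞ (W ⊞ H) C (PlaneBounded-⊞ W H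
      (PlaneBounded-⊙ a wholeSpace wholeSpace-planeBounded)
      (PlaneBounded-⊙ q offHyperplane (offKernel-planeBounded firstCoordinate firstCoordinate-linear)))
      (PlaneBounded-⊙ c offCodim2 offCodim2-planeBounded))
      (PlaneBounded-⊙ e (pointAt e₁) (pointAt-planeBounded e₁))
    where
    W H C P : Multiset dim
    W = a ⊙ wholeSpace
    H = q ⊙ offHyperplane
    C = c ⊙ offCodim2
    P = e ⊙ pointAt e₁

  total-construction : ∀ a q c e →
    total (construction a q c e) ≡ (a * 7 + q * 4 + c * 6 + e * 1) + (8 * a + (4 * q + 6 * c)) * V
  total-construction a q c e = begin
    total (construction a q c e)
      ≡⟨ trans (total-⊞ (W ⊞ H ⊞ C) P) (cong (_+ total P) (trans (total-⊞ (W ⊞ H) C) (cong (_+ total C) (total-⊞ W H)))) ⟩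
    total W + total H + total C + total P
      ≡⟨ cong₂ _+_ (cong₂ _+_ (cong₂ _+_ (total-⊙ a (wholeSpace {dim})) (total-⊙ q (offHyperplane {3 + k₀})))
                              (total-⊙ c (offCodim2 {2 + k₀})))
                   (total-⊙ e (pointAt e₁)) ⟩
    a * total (wholeSpace {dim}) + q * total (offHyperplane {3 + k₀}) + c * total (offCodim2 {2 + k₀}) + e * total (pointAt e₁)
      ≡⟨ cong₂ _+_ (cong₂ _+_ (cong₂ _+_ (cong (a *_) W-total) (cong (q *_) H-total)) (cong (c *_) C-total))
                   (cong (e *_) (total-pointAt {p = e₁} (λ ()))) ⟩
    a * (8 * V + 7) + q * (2 * (2 * (V + 1))) + c * (3 * (2 * (V + 1))) + e * 1
      ≡⟨ regroup a q c e V ⟩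
    (a * 7 + q * 4 + c * 6 + e * 1) + (8 * a + (4 * q + 6 * c)) * V ∎
    where
    open ≡-Reasoning
    W H C P : Multiset dim
    W = a ⊙ wholeSpace
    H = q ⊙ offHyperplane
    C = c ⊙ offCodim2
    P = e ⊙ pointAt e₁
    W-total : total (wholeSpace {dim}) ≡ 8 * V + 7
    W-total = +-cancelʳ-≡ 1 _ _ (trans (total-wholeSpace dim) (trans 2^dim≡8V+8 (sym (+-assoc (8 * V) 7 1))))
    H-total : total (offHyperplane {3 + k₀}) ≡ 2 * (2 * (V + 1))
    H-total = trans (total-offHyperplane (3 + k₀)) (cong (λ p → 2 * (2 * p)) (sym V+1≡2^[dim-3]))
    C-total : total (offCodim2 {2 + k₀}) ≡ 3 * (2 * (V + 1))
    C-total = trans (total-offCodim2 (2 + k₀)) (cong (λ p → 3 * (2 * p)) (sym V+1≡2^[dim-3]))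
    regroup : ∀ a q c e V → a * (8 * V + 7) + q * (2 * (2 * (V + 1))) + c * (3 * (2 * (V + 1))) + e * 1
                          ≡ (a * 7 + q * 4 + c * 6 + e * 1) + (8 * a + (4 * q + 6 * c)) * V
    regroup = solve-∀

  Optimum : ℕ → Set
  Optimum w = Σ ℕ (λ n → m2plane dim w n × IsMax (Griesmer dim w) n)

  griesmerExcess≤⇒≤ : ∀ {w} a t r → w ≡ 7 * a + r → r < floorSum t + 3 →
    ∀ {d} → griesmerExcess V d ≤ w → d ≤ (8 * a + t) * V
  griesmerExcess≤⇒≤ {w} a t r w≡7a+r r<3+floorSum {d} excess≤w with d ≤? (8 * a + t) * V
  ... | yes d≤D = d≤D
  ... | no d≰D = contradiction (+-cancelˡ-≤ (7 * a) _ _ (begin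
    7 * a + (floorSum t + 3)  ≡⟨ +-assoc (7 * a) _ 3 ⟨
    7 * a + floorSum t + 3    ≤⟨ griesmerExcess-beyond a t 1≤V (≰⇒> d≰D) ⟩
    griesmerExcess V d        ≤⟨ excess≤w ⟩
    w                         ≡⟨ w≡7a+r ⟩
    7 * a + r                 ∎)) (<⇒≱ r<3+floorSum)
    where open ≤-Reasoning

  Griesmer-at : ∀ {w} a t r → w ≡ 7 * a + r → griesmerExcess 1 t ≤ r → Griesmer dim w (w + (8 * a + t) * V)
  Griesmer-at {w} a t r w≡7a+r excess≤r = m≤m+n w D , (begin
    g 2 (dim ∸ 3) dim (w + D ∸ w)     ≡⟨ cong (g 2 (dim ∸ 3) dim) (m+n∸m≡n w D) ⟩
    g 2 (dim ∸ 3) dim D               ≡⟨ g≡ D ⟩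
    D + griesmerExcess V D            ≤⟨ +-monoʳ-≤ D (griesmerExcess-at a t 1≤V) ⟩
    D + (7 * a + griesmerExcess 1 t)  ≤⟨ +-monoʳ-≤ D (+-monoʳ-≤ (7 * a) excess≤r) ⟩
    D + (7 * a + r)                   ≡⟨ cong (D +_) w≡7a+r ⟨
    D + w                             ≡⟨ +-comm D w ⟩
    w + D                             ∎)
    where
    open ≤-Reasoning
    D = (8 * a + t) * V

  optimum : ∀ {w} a q c e → let r = 4 * q + 6 * c + e; t = 4 * q + 6 * c in
    w ≡ 7 * a + r → griesmerExcess 1 t ≤ r → r < floorSum t + 3 → Optimum w
  optimum {w} a q c e w≡7a+r excess≤r r<3+floorSum =
    N , ((construction a q c e , bounded , total≡N) , achievable≤N) , Griesmer-at a t r w≡7a+r excess≤r ,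
    λ n griesmer → ≤N (proj₁ griesmer) (Griesmer⇒excess≤ griesmer)
    where
    open ≤-Reasoning
    r = 4 * q + 6 * c + e
    t = 4 * q + 6 * c
    N = w + (8 * a + t) * V
    w≡ : a * 7 + q * 4 + c * 6 + e * 1 ≡ w
    w≡ = trans (normalise a q c e) (sym w≡7a+r)
      where
      normalise : ∀ a q c e → a * 7 + q * 4 + c * 6 + e * 1 ≡ 7 * a + (4 * q + 6 * c + e)
      normalise = solve-∀
    bounded : PlaneBounded (construction a q c e) w
    bounded = subst (PlaneBounded (construction a q c e)) w≡ (construction-planeBounded a q c e)
    total≡N : total (construction a q c e) ≡ N
    total≡N = trans (total-construction a q c e) (cong (_+ (8 * a + t) * V) w≡)
    ≤N : ∀ {n} → w ≤ n → griesmerExcess V (n ∸ w) ≤ w → n ≤ N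
    ≤N {n} w≤n excess≤w = begin
      n            ≡⟨ m+[n∸m]≡n w≤n ⟨
      w + (n ∸ w)  ≤⟨ +-monoʳ-≤ w (griesmerExcess≤⇒≤ a t r w≡7a+r r<3+floorSum excess≤w) ⟩
      N            ∎
    achievable≤N : ∀ m → Achievable dim w m → m ≤ N
    achievable≤N m (M , bounded′ , refl) with w ≤? total M
    ... | yes w≤m = ≤N w≤m (griesmer-upper-bound M 1≤V 2^dim≡8V+8 bounded′ w≤m)
    ... | no w≰m  = ≤-trans (<⇒≤ (≰⇒> w≰m)) (m≤m+n w _)

  carry : ∀ b r → 7 * b + (4 + (3 + r)) ≡ 7 * suc b + r
  carry = solve-∀

  -- The residue of w mod 7 selects r = 4q + 6c + e ∈ {4, 5, 6, 0, 1, 2, 10}; the two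
  -- inequalities between r and t = 4q + 6c are checked by evaluation.
  optimum-by-residue : ∀ {w} b j → j < 7 → w ≡ 7 * b + (4 + j) → Optimum w
  optimum-by-residue b 0 _ w≡ = optimum b 1 0 0 w≡ (≤ᵇ⇒≤ _ _ _) (≤ᵇ⇒≤ _ _ _)
  optimum-by-residue b 1 _ w≡ = optimum b 1 0 1 w≡ (≤ᵇ⇒≤ _ _ _) (≤ᵇ⇒≤ _ _ _)
  optimum-by-residue b 2 _ w≡ = optimum b 0 1 0 w≡ (≤ᵇ⇒≤ _ _ _) (≤ᵇ⇒≤ _ _ _)
  optimum-by-residue b 3 _ w≡ = optimum (suc b) 0 0 0 (trans w≡ (carry b 0)) (≤ᵇ⇒≤ _ _ _) (≤ᵇ⇒≤ _ _ _)
  optimum-by-residue b 4 _ w≡ = optimum (suc b) 0 0 1 (trans w≡ (carry b 1)) (≤ᵇ⇒≤ _ _ _) (≤ᵇ⇒≤ _ _ _)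
  optimum-by-residue b 5 _ w≡ = optimum (suc b) 0 0 2 (trans w≡ (carry b 2)) (≤ᵇ⇒≤ _ _ _) (≤ᵇ⇒≤ _ _ _)
  optimum-by-residue b 6 _ w≡ = optimum b 1 1 0 w≡ (≤ᵇ⇒≤ _ _ _) (≤ᵇ⇒≤ _ _ _)
  optimum-by-residue b (suc (suc (suc (suc (suc (suc (suc j))))))) j<7 _ = contradiction (m≤m+n 7 j) (<⇒≱ j<7)

mainTheorem6 : ∀ (k w : ℕ) → 4 ≤ k → 4 ≤ w →
    Σ ℕ (λ n → m2plane k w n ×
    IsMax (λ n′ → (w ≤ n′) × (g 2 (k ∸ 3) k (n′ ∸ w) ≤ n′)) n)
mainTheorem6 (suc (suc (suc (suc k₀)))) w (s≤s (s≤s (s≤s (s≤s z≤n)))) 4≤w =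
  optimum-by-residue ((w ∸ 4) / 7) ((w ∸ 4) % 7) (m%n<n (w ∸ 4) 7) (begin
    w                                          ≡⟨ m+[n∸m]≡n 4≤w ⟨
    4 + (w ∸ 4)                                ≡⟨ cong (4 +_) (m≡m%n+[m/n]*n (w ∸ 4) 7) ⟩
    4 + ((w ∸ 4) % 7 + (w ∸ 4) / 7 * 7)        ≡⟨ regroup ((w ∸ 4) % 7) ((w ∸ 4) / 7) ⟩
    7 * ((w ∸ 4) / 7) + (4 + (w ∸ 4) % 7)      ∎)
  where
  open Dimension k₀
  open ≡-Reasoning
  regroup : ∀ j b → 4 + (j + b * 7) ≡ 7 * b + (4 + j)
  regroup = solve-∀
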